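{- Let $H_1,H_2$ be bunchy graphs and let $M$ be a graph with $M(H_1)=M(H_2)=M$. Let $\Psi_i\in\hom_R(H_i,M)$ for $i=1,2$, and let $P=H_1\times_{\Psi_1,\Psi_2}H_2$. Let $G$ be a graph with right-resolvers $\Phi_i\in\hom_R(G,H_i)$, $i=1,2$. Then there exist a principal subgraph $C$ of $P$ and right-resolvers $\Delta_i\in\hom_R(G,C)$ such that $\Phi_i=\hat{\Psi}_i\circ\Delta_i$ for $i=1,2$ and $\partial\Delta_1=\partial\Delta_2$. In particular $H_i\leq_R C\leq_R G$, with $\hat{\Psi}_i|_C\in\hom_R(C,H_i)$.
   Context: All graphs are finite directed graphs $G$ with state set $V(G)$, edge set $E(G)$, source/target maps $s,t$; loops and parallel edges allowed; all graphs sink-free. $E_I(G)=s^{ -1}(I)$, $F(I)=t(E_I(G))$. A homomorphism $\Phi:G\to H$ is a pair of maps $\Phi$ on edges and $\partial\Phi$ on states commuting with $s,t$. Graphs are identified up to isomorphism. A right-resolver is a surjective homomorphism $\Phi$ such that $\Phi|_{E_I(G)}:E_I(G)\to E_{\partial\Phi(I)}(H)$ is bijective for every $I$; $\hom_R(G,H)$ denotes the set of these, and $H\leq_R G$ if it is nonempty. For each graph $G$ there is a unique $\leq_R$-minimal graph $M(G)\leq_R G$, and all right-resolvers $G\to M(G)$ share the same state map $\Sigma_G:V(G)\to V(M(G))$. A state $I$ of $G$ is bunchy if $\Sigma_G|_{F(I)}:F(I)\to F(\Sigma_G(I))$ is a bijection; $G$ is bunchy if every state is bunchy. A subgraph $C$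 of $P$ (subsets of states and edges with the restricted $s,t$) is principal if $E_I(C)=E_I(P)$ for every $I\in V(C)$. Fiber product: for homomorphisms $\Psi_i:H_i\to K$, $P=H_1\times_{\Psi_1,\Psi_2}H_2$ has states the pairs $(I_1,I_2)\in V(H_1)\times V(H_2)$ with $\partial\Psi_1(I_1)=\partial\Psi_2(I_2)$, edges the pairs $(e_1,e_2)\in E(H_1)\times E(H_2)$ with $\Psi_1(e_1)=\Psi_2(e_2)$, source and target taken componentwise, and $\hat\Psi_i:P\to H_i$ denotes the $i$-th coordinate projection. -}

module Defs where

open import Data.Nat using (ℕ)
open import Data.Fin using (Fin)
open import Data.Bool using (Bool; T)
open import Data.Product using (Σ; ∃; _×_; _,_; proj₁; proj₂)
open import Function.Bundles using (_↔_)
open import Relation.Binary.PropositionalEquality using (_≡_; refl; sym; trans; cong)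

record Graph : Set₁ where
  field
    V E : Set
    s t : E → V
open Graph public

Finite : Set → Set
Finite A = Σ ℕ λ n → A ↔ Fin n

SinkFree : Graph → Set
SinkFree G = ∀ (I : V G) → ∃ λ (e : E G) → s G e ≡ I

IsGraph : Graph → Set
IsGraph G = Finite (V G) × Finite (E G) × SinkFree G

record Hom (G H : Graph) : Set where
  field
    edge  : E G → E H
    state : V G → V H
    s-comm : ∀ e → s H (edge e) ≡ state (s G e)
    t-comm : ∀ e → t H (edge e) ≡ state (t G e)
open Hom public

_∘ₕ_ : ∀ {G H K} → Hom H K → Hom G H → Hom G K
_∘ₕ_ {G} {H} {K} Ψ Φ = record
  { edge  = λ e → edge Ψ (edge Φ e)
  ; state = λ I → state Ψ (state Φ I)
  ; s-comm = λ e → trans (s-comm Ψ (edge Φ e)) (cong (state Ψ) (s-comm Φ e))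
  ; t-comm = λ e → trans (t-comm Ψ (edge Φ e)) (cong (state Ψ) (t-comm Φ e))
  }

_≈ₕ_ : ∀ {G H} → Hom G H → Hom G H → Set
Φ ≈ₕ Ψ = (∀ e → edge Φ e ≡ edge Ψ e) × (∀ I → state Φ I ≡ state Ψ I)

LocallyBijective : ∀ {G H} → Hom G H → Set
LocallyBijective {G} {H} Φ =
  ∀ (I : V G) →
    (∀ e e' → s G e ≡ I → s G e' ≡ I → edge Φ e ≡ edge Φ e' → e ≡ e')
    × (∀ f → s H f ≡ state Φ I → ∃ λ e → s G e ≡ I × edge Φ e ≡ f)

SurjectiveHom : ∀ {G H} → Hom G H → Set
SurjectiveHom {G} {H} Φ =
  (∀ f → ∃ λ e → edge Φ e ≡ f) × (∀ J → ∃ λ I → state Φ I ≡ J)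

RightResolver : ∀ {G H} → Hom G H → Set
RightResolver Φ = SurjectiveHom Φ × LocallyBijective Φ

_≤R_ : Graph → Graph → Set
H ≤R G = Σ (Hom G H) RightResolver

Iso : Graph → Graph → Set
Iso G H = Σ (Hom G H) λ Φ → Σ (Hom H G) λ Ψ →
  ((∀ e → edge Ψ (edge Φ e) ≡ e) × (∀ I → state Ψ (state Φ I) ≡ I))
  × ((∀ f → edge Φ (edge Ψ f) ≡ f) × (∀ J → state Φ (state Ψ J) ≡ J))

-- M is (up to isomorphism) the ≤_R-minimal graph M(G) ≤_R G:
-- every graph K ≤_R M is isomorphic to M.
IsMinimalOf : Graph → Graph → Set₁
IsMinimalOf M G = IsGraph M × M ≤R G × (∀ K → IsGraph K → K ≤R M → Iso K M)

InF : (G : Graph) → V G → V G → Set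
InF G I J = ∃ λ e → s G e ≡ I × t G e ≡ J

BunchyAt : ∀ {G M} → Hom G M → V G → Set
BunchyAt {G} {M} Φ I =
  (∀ J J' → InF G I J → InF G I J' → state Φ J ≡ state Φ J' → J ≡ J')
  × (∀ K → InF M (state Φ I) K → ∃ λ J → InF G I J × state Φ J ≡ K)

-- Σ_G is the common state map of all right-resolvers G → M(G)
Bunchy : Graph → Set₁
Bunchy G = ∀ M → IsMinimalOf M G → (Φ : Hom G M) → RightResolver Φ →
  ∀ (I : V G) → BunchyAt Φ I

FibProd : ∀ {H₁ H₂ K} → Hom H₁ K → Hom H₂ K → Graph
FibProd {H₁} {H₂} {K} Ψ₁ Ψ₂ = record
  { V = Σ (V H₁ × V H₂) λ p → state Ψ₁ (proj₁ p) ≡ state Ψ₂ (proj₂ p)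
  ; E = Σ (E H₁ × E H₂) λ p → edge Ψ₁ (proj₁ p) ≡ edge Ψ₂ (proj₂ p)
  ; s = λ { ((e₁ , e₂) , q) → (s H₁ e₁ , s H₂ e₂) ,
        trans (sym (s-comm Ψ₁ e₁)) (trans (cong (s K) q) (s-comm Ψ₂ e₂)) }
  ; t = λ { ((e₁ , e₂) , q) → (t H₁ e₁ , t H₂ e₂) ,
        trans (sym (t-comm Ψ₁ e₁)) (trans (cong (t K) q) (t-comm Ψ₂ e₂)) }
  }

proj₁ₕ : ∀ {H₁ H₂ K} (Ψ₁ : Hom H₁ K) (Ψ₂ : Hom H₂ K) → Hom (FibProd Ψ₁ Ψ₂) H₁
proj₁ₕ Ψ₁ Ψ₂ = record
  { edge = λ e → proj₁ (proj₁ e) ; state = λ I → proj₁ (proj₁ I)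
  ; s-comm = λ _ → refl ; t-comm = λ _ → refl }

proj₂ₕ : ∀ {H₁ H₂ K} (Ψ₁ : Hom H₁ K) (Ψ₂ : Hom H₂ K) → Hom (FibProd Ψ₁ Ψ₂) H₂
proj₂ₕ Ψ₁ Ψ₂ = record
  { edge = λ e → proj₂ (proj₁ e) ; state = λ I → proj₂ (proj₁ I)
  ; s-comm = λ _ → refl ; t-comm = λ _ → refl }

record SubGraph (P : Graph) : Set where
  field
    inV : V P → Bool
    inE : E P → Bool
    s-in : ∀ e → T (inE e) → T (inV (s P e))
    t-in : ∀ e → T (inE e) → T (inV (t P e))
open SubGraph public

asGraph : ∀ {P} → SubGraph P → Graph
asGraph {P} C = record
  { V = Σ (V P) (λ I → T (inV C I))
  ; E = Σ (E P) (λ e → T (inE C e))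
  ; s = λ e → s P (proj₁ e) , s-in C (proj₁ e) (proj₂ e)
  ; t = λ e → t P (proj₁ e) , t-in C (proj₁ e) (proj₂ e)
  }

incl : ∀ {P} (C : SubGraph P) → Hom (asGraph C) P
incl C = record
  { edge = proj₁ ; state = proj₁ ; s-comm = λ _ → refl ; t-comm = λ _ → refl }

Principal : ∀ {P} → SubGraph P → Set
Principal {P} C = ∀ (I : V P) → T (inV C I) → ∀ e → s P e ≡ I → T (inE C e)

-- Ψ₁ ∘ Φ₁ and Ψ₂ ∘ Φ₂ are locally bijective maps G → M, and they agree on states. Indeed,
-- identify the two images of every state of G and close this up to an equivalence on M:
-- transporting out-edges through G shows that equivalent states have their out-edges in
-- bijection with equivalent targets, so the quotient of M is a right-resolver image of M,
-- and minimality of M forces the quotient map to be injective on states.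
-- Hence every (Φ₁ I , Φ₂ I) is a state of P; let C consist of these pairs and all edges of
-- P leaving them. Bunchiness keeps C closed under targets, since a state of Hᵢ has at most
-- one follower over each follower in M. Δᵢ sends an edge e to Φᵢ e paired with its unique
-- partner over M in the other factor; the projections of C inherit local bijectivity from
-- the Ψᵢ, and each Δᵢ from Φᵢ = Ψ̂ᵢ ∘ Δᵢ.
module Submission where

open import Defs
open import Axiom.UniquenessOfIdentityProofs.WithK using (uip)
open import Data.Bool using (Bool; true; false; T)
open import Data.Bool.Properties using (T-irrelevant)
open import Data.Empty using (⊥-elim)
open import Data.Maybe as Maybe using (Maybe; just; nothing)
open import Data.Maybe.Properties using (just-injective)
open import Data.Fin as Fin using (Fin; zero; suc; punchOut)
open import Data.Fin.Properties using (any?; 0↔⊥; 1↔⊤; +↔⊎; punchOut-injective; injective⇒≤)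
open import Data.Nat using (ℕ; zero; suc; _+_; _≤_; z≤n; s≤s)
open import Data.Nat.Properties using (<-irrefl; ≤-trans)
open import Data.Fin.Subset using (Subset; _∈_; _∉_; _⊂_; _∪_; ⁅_⁆; ∣_∣)
open import Data.Fin.Subset.Properties
  using (_∈?_; x∈⁅x⁆; x∈⁅y⁆⇒x≡y; x∈p∪q⁺; x∈p∪q⁻; p⊆p∪q; p⊂q⇒∣p∣<∣q∣; ∣p∣≤n)
open import Data.Product as Product using (Σ; ∃; _×_; _,_; proj₁; proj₂)
open import Data.Product.Properties using (Σ-≡,≡→≡)
open import Data.Product.Function.Dependent.Propositional using (Σ-↔)
open import Data.Sum using (_⊎_; inj₁; inj₂; swap)
open import Data.Sum.Function.Propositional using (_⊎-↔_)
open import Function using (_∘_; id)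
open import Function.Definitions using (Injective; StrictlySurjective)
open import Function.Bundles using (_↔_; _⇔_; Inverse; Injection; mk↔ₛ′; mk⇔)
open import Function.Properties.Inverse using (↔-refl; ↔-sym; ↔-trans; ↔⇒↣)
open import Relation.Binary.Definitions using (DecidableEquality)
open import Relation.Binary.Structures using (IsEquivalence)
open import Relation.Binary.PropositionalEquality
  using (_≡_; _≢_; refl; sym; trans; cong; cong₂; subst; subst₂; module ≡-Reasoning)
open import Relation.Nullary using (Dec; does; yes; no; Irrelevant)
open import Relation.Nullary.Decidable
  using (via-injection; map′; decidable-stable; _×-dec_; _⊎-dec_; ¬?; ⌊_⌋; toWitness; fromWitness; does-⇔; isYes≗does)

subtype-≡ : ∀ {A : Set} {P : A → Set} → (∀ {a} → Irrelevant (P a)) →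
            {u v : Σ A P} → proj₁ u ≡ proj₁ v → u ≡ v
subtype-≡ irr p = Σ-≡,≡→≡ (p , irr _ _)

finite-↔ : ∀ {A B : Set} → A ↔ B → Finite B → Finite A
finite-↔ A↔B (n , B↔Fin) = n , ↔-trans A↔B B↔Fin

finite-⊎ : ∀ {A B : Set} → Finite A → Finite B → Finite (A ⊎ B)
finite-⊎ (m , A↔Fin) (n , B↔Fin) = m + n , ↔-trans (A↔Fin ⊎-↔ B↔Fin) (↔-sym +↔⊎)

finite-T : ∀ b → Finite (T b)
finite-T true  = 1 , ↔-sym 1↔⊤
finite-T false = 0 , ↔-sym 0↔⊥

Σ-Fin-suc↔ : ∀ {n} (P : Fin (suc n) → Set) → Σ (Fin (suc n)) P ↔ (P zero ⊎ Σ (Fin n) (P ∘ suc))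
Σ-Fin-suc↔ P = mk↔ₛ′ to from
  (λ { (inj₁ _) → refl ; (inj₂ _) → refl }) (λ { (zero , _) → refl ; (suc _ , _) → refl })
  where
  to : Σ (Fin _) P → P zero ⊎ Σ (Fin _) (P ∘ suc)
  to (zero , p)  = inj₁ p
  to (suc i , p) = inj₂ (i , p)
  from : P zero ⊎ Σ (Fin _) (P ∘ suc) → Σ (Fin _) P
  from (inj₁ p)       = zero , p
  from (inj₂ (i , p)) = suc i , p

finite-Σ-Fin : ∀ n (P : Fin n → Bool) → Finite (Σ (Fin n) (T ∘ P))
finite-Σ-Fin zero    P = 0 , mk↔ₛ′ (λ ()) (λ ()) (λ ()) (λ ())
finite-Σ-Fin (suc n) P =
  finite-↔ (Σ-Fin-suc↔ (T ∘ P)) (finite-⊎ (finite-T (P zero)) (finite-Σ-Fin n (P ∘ suc)))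

finite-Σ : ∀ {A : Set} → Finite A → (P : A → Bool) → Finite (Σ A (T ∘ P))
finite-Σ (n , A↔Fin) P =
  finite-↔ (↔-sym (Σ-↔ (↔-sym A↔Fin) ↔-refl)) (finite-Σ-Fin n (P ∘ Inverse.from A↔Fin))

finite-≟ : ∀ {A : Set} → Finite A → DecidableEquality A
finite-≟ (n , A↔Fin) = via-injection (↔⇒↣ A↔Fin) Fin._≟_

finite-any? : ∀ {A : Set} → Finite A → {P : A → Set} → (∀ a → Dec (P a)) → Dec (∃ P)
finite-any? (n , A↔Fin) {P} P? =
  map′ (λ (i , p) → from i , p) (λ (a , pa) → to a , subst P (sym (strictlyInverseʳ a)) pa) (any? (P? ∘ from))
  where open Inverse A↔Fin

Fin-injective⇒surjective : ∀ {n} (g : Fin n → Fin n) → Injective _≡_ _≡_ g → StrictlySurjective _≡_ g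
Fin-injective⇒surjective {suc m} g g-inj c with any? (λ j → g j Fin.≟ c)
... | yes hit = hit
... | no miss = ⊥-elim (<-irrefl refl (injective⇒≤ punchOut-c∘g-injective))
  where
  g≢c : ∀ j → c ≢ g j
  g≢c j c≡gj = miss (j , sym c≡gj)
  punchOut-c∘g-injective : Injective _≡_ _≡_ (λ j → punchOut (g≢c j))
  punchOut-c∘g-injective eq = g-inj (punchOut-injective (g≢c _) (g≢c _) eq)

finite-injective⇒surjective : ∀ {A : Set} → Finite A → (g : A → A) →
                              Injective _≡_ _≡_ g → StrictlySurjective _≡_ g
finite-injective⇒surjective (n , A↔Fin) g g-inj c = from (proj₁ hit) , to-injective (proj₂ hit)
  where
  open Inverse A↔Fin using (to; from)
  to-injective : Injective _≡_ _≡_ to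
  to-injective = Injection.injective (↔⇒↣ A↔Fin)
  from-injective : Injective _≡_ _≡_ from
  from-injective = Injection.injective (↔⇒↣ (↔-sym A↔Fin))
  hit : ∃ λ j → to (g (from j)) ≡ to c
  hit = Fin-injective⇒surjective (to ∘ g ∘ from) (from-injective ∘ g-inj ∘ to-injective) (to c)

finite-surjective⇒injective : ∀ {A : Set} → Finite A → (h : A → A) →
                              StrictlySurjective _≡_ h → Injective _≡_ _≡_ h
finite-surjective⇒injective {A} fin h h-surj {x} {y} hx≡hy =
  trans (sym (section∘h x)) (trans (cong section hx≡hy) (section∘h y))
  where
  section : A → A
  section = proj₁ ∘ h-surj
  h∘section : ∀ z → h (section z) ≡ z
  h∘section = proj₂ ∘ h-surj
  section-injective : Injective _≡_ _≡_ section
  section-injective {z} {w} eq = trans (sym (h∘section z)) (trans (cong h eq) (h∘section w))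
  -- the section is injective, hence onto, so it is also a retraction of h
  section∘h : ∀ z → section (h z) ≡ z
  section∘h z with i , si≡z ← finite-injective⇒surjective fin section section-injective z =
    trans (cong (section ∘ h) (sym si≡z)) (trans (cong section (h∘section i)) si≡z)

Out : (G : Graph) → V G → Set
Out G I = Σ (E G) λ e → s G e ≡ I

fibre-≡ : ∀ {A B : Set} {f : A → B} {b} {u v : Σ A λ a → f a ≡ b} → proj₁ u ≡ proj₁ v → u ≡ v
fibre-≡ = subtype-≡ uip

Out↔ : ∀ {G H} (Φ : Hom G H) → LocallyBijective Φ → ∀ I → Out G I ↔ Out H (state Φ I)
Out↔ {G} {H} Φ Φ-lb I =
  mk↔ₛ′ image lift (λ (f , sf) → fibre-≡ (proj₂ (proj₂ (lift′ f sf)))) lift∘image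
  where
  image : Out G I → Out H (state Φ I)
  image (e , se) = edge Φ e , trans (s-comm Φ e) (cong (state Φ) se)
  lift′ : ∀ f → s H f ≡ state Φ I → ∃ λ e → s G e ≡ I × edge Φ e ≡ f
  lift′ = proj₂ (Φ-lb I)
  lift : Out H (state Φ I) → Out G I
  lift (f , sf) = proj₁ (lift′ f sf) , proj₁ (proj₂ (lift′ f sf))
  lift∘image : ∀ o → lift (image o) ≡ o
  lift∘image (e , se) with e′ , se′ , Φe′≡Φe ← lift′ (edge Φ e) (proj₂ (image (e , se))) =
    fibre-≡ (proj₁ (Φ-lb I) e′ e se′ se Φe′≡Φe)

OutMatching : (G : Graph) → (V G → V G → Set) → V G → V G → Set
OutMatching G _~_ x y = Σ (Out G x ↔ Out G y) λ m → ∀ o → t G (proj₁ o) ~ t G (proj₁ (Inverse.to m o))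

module _ {G : Graph} {_~_ : V G → V G → Set} (~-equiv : IsEquivalence _~_) where
  open IsEquivalence ~-equiv renaming (refl to ~-refl; sym to ~-sym; trans to ~-trans)

  outMatching-refl : ∀ {x} → OutMatching G _~_ x x
  outMatching-refl = ↔-refl , λ _ → ~-refl

  outMatching-sym : ∀ {x y} → OutMatching G _~_ x y → OutMatching G _~_ y x
  outMatching-sym (m , m-~) = ↔-sym m , λ o →
    ~-sym (subst (λ o′ → t G (proj₁ (from o)) ~ t G (proj₁ o′)) (strictlyInverseˡ o) (m-~ (from o)))
    where open Inverse m using (from; strictlyInverseˡ)

  outMatching-trans : ∀ {x y z} → OutMatching G _~_ x y → OutMatching G _~_ y z → OutMatching G _~_ x z
  outMatching-trans (m , m-~) (m′ , m′-~) = ↔-trans m m′ , λ o → ~-trans (m-~ o) (m′-~ (Inverse.to m o))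

outMatching-images : ∀ {G M : Graph} {α β : Hom G M} → LocallyBijective α → LocallyBijective β →
                     {_~_ : V M → V M → Set} → (∀ J → state α J ~ state β J) →
                     ∀ I → OutMatching M _~_ (state α I) (state β I)
outMatching-images {G} {M} {α} {β} α-lb β-lb {_~_} α~β I =
  ↔-trans (↔-sym (Out↔ α α-lb I)) (Out↔ β β-lb I) , targets
  where
  open Inverse (Out↔ α α-lb I) using (from; strictlyInverseˡ)
  targets : ∀ o → t M (proj₁ o) ~ t M (edge β (proj₁ (from o)))
  targets o = subst₂ _~_
    (trans (sym (t-comm α (proj₁ (from o)))) (cong (t M ∘ proj₁) (strictlyInverseˡ o)))
    (sym (t-comm β (proj₁ (from o))))
    (α~β (t G (proj₁ (from o))))

module EquivalenceClosure {A : Set} (fin : Finite A) (R : A → A → Set)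
                          (R? : ∀ a b → Dec (R a b)) (R-sym : ∀ {a b} → R a b → R b a) where
  private
    n : ℕ
    n = proj₁ fin
    open Inverse (proj₂ fin) using (to)
    to-injective : Injective _≡_ _≡_ to
    to-injective = Injection.injective (↔⇒↣ (proj₂ fin))

  Closed : Subset n → Set
  Closed U = ∀ {a b} → R a b → to a ∈ U → to b ∈ U

  infix 4 _≈_
  _≈_ : A → A → Set
  a ≈ b = ∀ U → Closed U → to a ∈ U → to b ∈ U

  ≈-refl : ∀ {a} → a ≈ a
  ≈-refl U _ a∈U = a∈U

  ≈-trans : ∀ {a b c} → a ≈ b → b ≈ c → a ≈ c
  ≈-trans a≈b b≈c U closed a∈U = b≈c U closed (a≈b U closed a∈U)

  R⇒≈ : ∀ {a b} → R a b → a ≈ b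
  R⇒≈ r U closed = closed r

  private
    Violation : Subset n → Set
    Violation U = ∃ λ a → ∃ λ b → R a b × to a ∈ U × to b ∉ U

    closed-or-violated : ∀ U → Closed U ⊎ Violation U
    closed-or-violated U
      with finite-any? fin (λ a → finite-any? fin λ b → R? a b ×-dec (to a ∈? U) ×-dec ¬? (to b ∈? U))
    ... | yes violation = inj₂ violation
    ... | no ¬violation = inj₁ λ {a} {b} r a∈U →
            decidable-stable (to b ∈? U) (λ b∉U → ¬violation (a , b , r , a∈U , b∉U))

  module _ (Q : A → Set) (Q-step : ∀ {a b} → R a b → Q a → Q b) {a : A} (Qa : Q a) where
    private
      Saturation : ℕ → Set
      Saturation k = Σ (Subset n) λ U → to a ∈ U × (∀ b → to b ∈ U → Q b) × (Closed U ⊎ k ≤ ∣ U ∣)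

      -- each round adds an R-neighbour outside U, so after n + 1 rounds U must be closed
      saturate : ∀ k → Saturation k
      saturate zero = ⁅ to a ⁆ , x∈⁅x⁆ (to a) ,
        (λ b b∈ → subst Q (to-injective (sym (x∈⁅y⁆⇒x≡y _ b∈))) Qa) , inj₂ z≤n
      saturate (suc k) with saturate k
      ... | U , a∈U , U⊆Q , inj₁ closed = U , a∈U , U⊆Q , inj₁ closed
      ... | U , a∈U , U⊆Q , inj₂ k≤∣U∣ with closed-or-violated U
      ...   | inj₁ closed = U , a∈U , U⊆Q , inj₁ closed
      ...   | inj₂ (b , c , r , b∈U , c∉U) =
                U ∪ ⁅ to c ⁆ , x∈p∪q⁺ (inj₁ a∈U) , U′⊆Q ,
                inj₂ (≤-trans (s≤s k≤∣U∣) (p⊂q⇒∣p∣<∣q∣ U⊂U′))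
        where
        U′⊆Q : ∀ d → to d ∈ U ∪ ⁅ to c ⁆ → Q d
        U′⊆Q d d∈ with x∈p∪q⁻ U ⁅ to c ⁆ d∈
        ... | inj₁ d∈U = U⊆Q d d∈U
        ... | inj₂ d∈c = subst Q (to-injective (sym (x∈⁅y⁆⇒x≡y _ d∈c))) (Q-step r (U⊆Q b b∈U))
        U⊂U′ : U ⊂ U ∪ ⁅ to c ⁆
        U⊂U′ = p⊆p∪q _ , to c , x∈p∪q⁺ (inj₂ (x∈⁅x⁆ _)) , c∉U

    closedSaturation : Σ (Subset n) λ U → Closed U × to a ∈ U × (∀ b → to b ∈ U → Q b)
    closedSaturation with saturate (suc n)
    ... | U , a∈U , U⊆Q , inj₁ closed = U , closed , a∈U , U⊆Q
    ... | U , _ , _ , inj₂ n<∣U∣ = ⊥-elim (<-irrefl refl (≤-trans n<∣U∣ (∣p∣≤n U)))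

  ≈-induction : (Q : A → Set) → (∀ {a b} → R a b → Q a → Q b) → ∀ {a b} → Q a → a ≈ b → Q b
  ≈-induction Q Q-step {b = b} Qa a≈b
    with U , closed , a∈U , U⊆Q ← closedSaturation Q Q-step Qa = U⊆Q b (a≈b U closed a∈U)

  ≈-sym : ∀ {a b} → a ≈ b → b ≈ a
  ≈-sym {a} = ≈-induction (_≈ a) (λ r b≈a → ≈-trans (R⇒≈ (R-sym r)) b≈a) ≈-refl

  ≈-isEquivalence : IsEquivalence _≈_
  ≈-isEquivalence = record { refl = ≈-refl ; sym = ≈-sym ; trans = ≈-trans }

  -- the closed saturation of a under a ≈_ is exactly its ≈-class
  _≈?_ : ∀ a b → Dec (a ≈ b)
  a ≈? b
    with U , closed , a∈U , U⊆[a] ← closedSaturation (a ≈_) (λ r a≈b → ≈-trans a≈b (R⇒≈ r)) ≈-refl =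
    map′ (U⊆[a] b) (λ a≈b → a≈b U closed a∈U) (to b ∈? U)

first : ∀ {n} → (Fin n → Bool) → Maybe (Fin n)
first {zero}  p = nothing
first {suc n} p with p zero
... | true  = just zero
... | false = Maybe.map suc (first (p ∘ suc))

first-sound : ∀ {n} (p : Fin n → Bool) {i} → first p ≡ just i → T (p i)
first-sound {suc n} p eq with p zero in p0
first-sound {suc n} p refl | true = subst T (sym p0) _
first-sound {suc n} p eq   | false with first (p ∘ suc) in rest
first-sound {suc n} p refl | false | just i = first-sound (p ∘ suc) rest

first-complete : ∀ {n} (p : Fin n → Bool) {i} → T (p i) → ∃ λ j → first p ≡ just j
first-complete {suc n} p {i} pi with p zero in p0 | i
... | true  | _      = zero , refl
... | false | zero   = ⊥-elim (subst T p0 pi)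
... | false | suc i′ = Product.map suc (cong (Maybe.map suc)) (first-complete (p ∘ suc) pi)

first-cong : ∀ {n} {p q : Fin n → Bool} → (∀ i → p i ≡ q i) → first p ≡ first q
first-cong {zero}  p≗q = refl
first-cong {suc n} {p} {q} p≗q with p zero | q zero | p≗q zero
... | true  | true  | refl = refl
... | false | false | refl = cong (Maybe.map suc) (first-cong (p≗q ∘ suc))

module Representatives {A : Set} (fin : Finite A) {_~_ : A → A → Set}
                       (~-equiv : IsEquivalence _~_) (_~?_ : ∀ a b → Dec (a ~ b)) where
  private
    open IsEquivalence ~-equiv renaming (refl to ~-refl; sym to ~-sym; trans to ~-trans)
    open Inverse (proj₂ fin) using (to; from; strictlyInverseʳ)

    relatedTo : A → Fin (proj₁ fin) → Bool
    relatedTo x i = ⌊ from i ~? x ⌋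

    relatedTo-cong : ∀ {x y} → x ~ y → ∀ i → relatedTo x i ≡ relatedTo y i
    relatedTo-cong {x} {y} x~y i = begin
      ⌊ from i ~? x ⌋    ≡⟨ isYes≗does (from i ~? x) ⟩
      does (from i ~? x) ≡⟨ does-⇔ ~x⇔~y (from i ~? x) (from i ~? y) ⟩
      does (from i ~? y) ≡⟨ sym (isYes≗does (from i ~? y)) ⟩
      ⌊ from i ~? y ⌋    ∎
      where
      open ≡-Reasoning
      ~x⇔~y : (from i ~ x) ⇔ (from i ~ y)
      ~x⇔~y = mk⇔ (λ z~x → ~-trans z~x x~y) (λ z~y → ~-trans z~y (~-sym x~y))

    firstRelated : ∀ x → ∃ λ i → first (relatedTo x) ≡ just i
    firstRelated x = first-complete (relatedTo x) (fromWitness (subst (_~ x) (sym (strictlyInverseʳ x)) ~-refl))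

  rep : A → A
  rep x = from (proj₁ (firstRelated x))

  rep-~ : ∀ x → rep x ~ x
  rep-~ x = toWitness (first-sound (relatedTo x) (proj₂ (firstRelated x)))

  rep-cong : ∀ {x y} → x ~ y → rep x ≡ rep y
  rep-cong {x} {y} x~y = cong from (just-injective (begin
    just (proj₁ (firstRelated x)) ≡⟨ sym (proj₂ (firstRelated x)) ⟩
    first (relatedTo x)           ≡⟨ first-cong (relatedTo-cong x~y) ⟩
    first (relatedTo y)           ≡⟨ proj₂ (firstRelated y) ⟩
    just (proj₁ (firstRelated y)) ∎))
    where open ≡-Reasoning

locallyBijective⇒rightResolver : ∀ {G H} (Φ : Hom G H) →
                                 StrictlySurjective _≡_ (state Φ) → LocallyBijective Φ → RightResolver Φ
locallyBijective⇒rightResolver {G} {H} Φ surj Φ-lb = (edge-surj , surj) , Φ-lb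
  where
  edge-surj : StrictlySurjective _≡_ (edge Φ)
  edge-surj f with I , ΦI≡sf ← surj (s H f)
               with e , _ , Φe≡f ← proj₂ (Φ-lb I) f (sym ΦI≡sf) = e , Φe≡f

∘-locallyBijective : ∀ {G H K} {Φ : Hom G H} {Ψ : Hom H K} →
                     LocallyBijective Φ → LocallyBijective Ψ → LocallyBijective (Ψ ∘ₕ Φ)
∘-locallyBijective {G} {H} {K} {Φ} {Ψ} Φ-lb Ψ-lb I = injective , surjective
  where
  sΦ : ∀ {e} → s G e ≡ I → s H (edge Φ e) ≡ state Φ I
  sΦ {e} se = trans (s-comm Φ e) (cong (state Φ) se)
  injective : ∀ e e′ → s G e ≡ I → s G e′ ≡ I →
              edge Ψ (edge Φ e) ≡ edge Ψ (edge Φ e′) → e ≡ e′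
  injective e e′ se se′ eq =
    proj₁ (Φ-lb I) e e′ se se′ (proj₁ (Ψ-lb (state Φ I)) _ _ (sΦ se) (sΦ se′) eq)
  surjective : ∀ f → s K f ≡ state Ψ (state Φ I) → ∃ λ e → s G e ≡ I × edge Ψ (edge Φ e) ≡ f
  surjective f sf with f′ , sf′ , Ψf′≡f ← proj₂ (Ψ-lb (state Φ I)) f sf
                  with e , se , Φe≡f′ ← proj₂ (Φ-lb I) f′ sf′ =
    e , se , trans (cong (edge Ψ) Φe≡f′) Ψf′≡f

locallyBijective-factor : ∀ {G C H} {Δ : Hom G C} {π : Hom C H} →
                          LocallyBijective (π ∘ₕ Δ) → LocallyBijective π → LocallyBijective Δ
locallyBijective-factor {G} {C} {H} {Δ} {π} πΔ-lb π-lb I = injective , surjective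
  where
  injective : ∀ e e′ → s G e ≡ I → s G e′ ≡ I → edge Δ e ≡ edge Δ e′ → e ≡ e′
  injective e e′ se se′ eq = proj₁ (πΔ-lb I) e e′ se se′ (cong (edge π) eq)
  surjective : ∀ c → s C c ≡ state Δ I → ∃ λ e → s G e ≡ I × edge Δ e ≡ c
  surjective c sc
    with e , se , πΔe≡πc ← proj₂ (πΔ-lb I) (edge π c) (trans (s-comm π c) (cong (state π) sc)) =
    e , se , proj₁ (π-lb (state Δ I)) _ c (trans (s-comm Δ e) (cong (state Δ) se)) sc πΔe≡πc

iso⇒stateInjective : ∀ {M K} → Finite (V M) → Iso K M → (ρ : Hom M K) →
                     StrictlySurjective _≡_ (state ρ) → Injective _≡_ _≡_ (state ρ)
iso⇒stateInjective fin (Φ , Ψ , _ , (_ , ΦΨ)) ρ ρ-surj ρx≡ρy =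
  finite-surjective⇒injective fin (state Φ ∘ state ρ) surjective (cong (state Φ) ρx≡ρy)
  where
  surjective : StrictlySurjective _≡_ (state Φ ∘ state ρ)
  surjective y with x , ρx≡Ψy ← ρ-surj (state Ψ y) = x , trans (cong (state Φ) ρx≡Ψy) (ΦΨ y)

module Quotient (M : Graph) (M-graph : IsGraph M) {_~_ : V M → V M → Set}
                (~-equiv : IsEquivalence _~_) (_~?_ : ∀ x y → Dec (x ~ y))
                (compatible : ∀ {x y} → x ~ y → OutMatching M _~_ x y) where
  private
    open IsEquivalence ~-equiv using () renaming (sym to ~-sym)
    open Representatives (proj₁ M-graph) ~-equiv _~?_

    isRep : V M → Bool
    isRep x = ⌊ finite-≟ (proj₁ M-graph) (rep x) x ⌋

    rep-isRep : ∀ x → T (isRep (rep x))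
    rep-isRep x = fromWitness (rep-cong (rep-~ x))

    matchRep : ∀ x → OutMatching M _~_ x (rep x)
    matchRep x = compatible (~-sym (rep-~ x))

  -- one state per ~-class; the edges leaving a class are those leaving its representative
  M/~ : Graph
  M/~ = record
    { V = Σ (V M) (T ∘ isRep)
    ; E = Σ (E M) (T ∘ isRep ∘ s M)
    ; s = λ (e , r) → s M e , r
    ; t = λ (e , _) → rep (t M e) , rep-isRep (t M e)
    }

  M/~-isGraph : IsGraph M/~
  M/~-isGraph = finite-Σ (proj₁ M-graph) isRep , finite-Σ (proj₁ (proj₂ M-graph)) (isRep ∘ s M) , sinkFree
    where
    sinkFree : SinkFree M/~
    sinkFree (x , r) with e , se ← proj₂ (proj₂ M-graph) x =
      (e , subst (T ∘ isRep) (sym se) r) , subtype-≡ T-irrelevant se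

  quotientMap : Hom M M/~
  quotientMap = record
    { edge   = λ e → proj₁ (moved e) , subst (T ∘ isRep) (sym (proj₂ (moved e))) (rep-isRep (s M e))
    ; state  = λ x → rep x , rep-isRep x
    ; s-comm = λ e → subtype-≡ T-irrelevant (proj₂ (moved e))
    ; t-comm = λ e → subtype-≡ T-irrelevant (rep-cong (~-sym (proj₂ (matchRep (s M e)) (e , refl))))
    }
    where
    moved : ∀ e → Out M (rep (s M e))
    moved e = Inverse.to (proj₁ (matchRep (s M e))) (e , refl)

  private
    quotientMap-out : ∀ {x} (o : Out M x) →
                      proj₁ (edge quotientMap (proj₁ o)) ≡ proj₁ (Inverse.to (proj₁ (matchRep x)) o)
    quotientMap-out (e , refl) = refl

  quotientMap-rightResolver : RightResolver quotientMap
  quotientMap-rightResolver = locallyBijective⇒rightResolver quotientMap stateSurjective locallyBijective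
    where
    stateSurjective : StrictlySurjective _≡_ (state quotientMap)
    stateSurjective (y , r) = y , subtype-≡ T-irrelevant (toWitness r)
    locallyBijective : LocallyBijective quotientMap
    locallyBijective x = injective , surjective
      where
      open Inverse (proj₁ (matchRep x)) using (to; from; strictlyInverseˡ)
      to-injective : Injective _≡_ _≡_ to
      to-injective = Injection.injective (↔⇒↣ (proj₁ (matchRep x)))
      injective : ∀ e e′ → s M e ≡ x → s M e′ ≡ x →
                  edge quotientMap e ≡ edge quotientMap e′ → e ≡ e′
      injective e e′ se se′ eq = cong proj₁ (to-injective {e , se} {e′ , se′} (fibre-≡
        (trans (sym (quotientMap-out (e , se))) (trans (cong proj₁ eq) (quotientMap-out (e′ , se′))))))
      surjective : ∀ f → s M/~ f ≡ state quotientMap x → ∃ λ e → s M e ≡ x × edge quotientMap e ≡ f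
      surjective (f , r) sf = proj₁ o , proj₂ o ,
        subtype-≡ T-irrelevant (trans (quotientMap-out o) (cong proj₁ (strictlyInverseˡ (f , cong proj₁ sf))))
        where
        o : Out M x
        o = from (f , cong proj₁ sf)

  quotientMap-identifies : ∀ {x y} → x ~ y → state quotientMap x ≡ state quotientMap y
  quotientMap-identifies x~y = subtype-≡ T-irrelevant (rep-cong x~y)

minimal⇒uniqueStateMap : ∀ {G M} → Finite (V G) → IsGraph M →
                         (∀ K → IsGraph K → K ≤R M → Iso K M) →
                         (α β : Hom G M) → LocallyBijective α → LocallyBijective β →
                         ∀ I → state α I ≡ state β I
minimal⇒uniqueStateMap {G} {M} finG M-graph M-minimal α β α-lb β-lb I =
  iso⇒stateInjective finM (M-minimal M/~ M/~-isGraph (quotientMap , quotientMap-rightResolver))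
    quotientMap (proj₂ (proj₁ quotientMap-rightResolver)) (quotientMap-identifies (images-≈ I))
  where
  finM : Finite (V M)
  finM = proj₁ M-graph
  _≟_ : DecidableEquality (V M)
  _≟_ = finite-≟ finM

  Images : V M → V M → Set
  Images x y = ∃ λ J → (state α J ≡ x × state β J ≡ y) ⊎ (state α J ≡ y × state β J ≡ x)

  images? : ∀ x y → Dec (Images x y)
  images? x y = finite-any? finG λ J →
    ((state α J ≟ x) ×-dec (state β J ≟ y)) ⊎-dec ((state α J ≟ y) ×-dec (state β J ≟ x))

  images-sym : ∀ {x y} → Images x y → Images y x
  images-sym (J , images) = J , swap images

  open EquivalenceClosure finM Images images? images-sym

  images-≈ : ∀ J → state α J ≈ state β J
  images-≈ J = R⇒≈ (J , inj₁ (refl , refl))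

  compatible : ∀ {x y} → x ≈ y → OutMatching M _≈_ x y
  compatible {x} = ≈-induction (OutMatching M _≈_ x) step (outMatching-refl ≈-isEquivalence)
    where
    matching : ∀ J → OutMatching M _≈_ (state α J) (state β J)
    matching = outMatching-images {α = α} {β} α-lb β-lb {_≈_} images-≈
    step : ∀ {y z} → Images y z → OutMatching M _≈_ x y → OutMatching M _≈_ x z
    step (J , inj₁ (refl , refl)) m = outMatching-trans ≈-isEquivalence m (matching J)
    step (J , inj₂ (refl , refl)) m =
      outMatching-trans ≈-isEquivalence m (outMatching-sym ≈-isEquivalence (matching J))

  open Quotient M M-graph ≈-isEquivalence _≈?_ compatible

module _ {H₁ H₂ K : Graph} (Ψ₁ : Hom H₁ K) (Ψ₂ : Hom H₂ K) where
  private
    P : Graph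
    P = FibProd Ψ₁ Ψ₂

  fibProd-state-≡ : {u v : V P} → proj₁ u ≡ proj₁ v → u ≡ v
  fibProd-state-≡ = subtype-≡ uip

  fibProd-edge-≡ : {c d : E P} → proj₁ c ≡ proj₁ d → c ≡ d
  fibProd-edge-≡ = subtype-≡ uip

  proj₁ₕ-locallyBijective : LocallyBijective Ψ₂ → LocallyBijective (proj₁ₕ Ψ₁ Ψ₂)
  proj₁ₕ-locallyBijective Ψ₂-lb ((I₁ , I₂) , q) = injective , surjective
    where
    injective : ∀ c d → s P c ≡ ((I₁ , I₂) , q) → s P d ≡ ((I₁ , I₂) , q) →
                proj₁ (proj₁ c) ≡ proj₁ (proj₁ d) → c ≡ d
    injective ((e₁ , e₂) , r) ((e₁′ , e₂′) , r′) sc sd refl = fibProd-edge-≡ (cong (e₁ ,_)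
      (proj₁ (Ψ₂-lb I₂) e₂ e₂′ (cong (proj₂ ∘ proj₁) sc) (cong (proj₂ ∘ proj₁) sd)
        (trans (sym r) r′)))
    surjective : ∀ f₁ → s H₁ f₁ ≡ I₁ →
                 ∃ λ c → s P c ≡ ((I₁ , I₂) , q) × proj₁ (proj₁ c) ≡ f₁
    surjective f₁ sf₁
      with e₂ , se₂ , Ψ₂e₂≡Ψ₁f₁ ← proj₂ (Ψ₂-lb I₂) (edge Ψ₁ f₁)
                                   (trans (s-comm Ψ₁ f₁) (trans (cong (state Ψ₁) sf₁) q)) =
      ((f₁ , e₂) , sym Ψ₂e₂≡Ψ₁f₁) , fibProd-state-≡ (cong₂ _,_ sf₁ se₂) , refl

  proj₂ₕ-locallyBijective : LocallyBijective Ψ₁ → LocallyBijective (proj₂ₕ Ψ₁ Ψ₂)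
  proj₂ₕ-locallyBijective Ψ₁-lb ((I₁ , I₂) , q) = injective , surjective
    where
    injective : ∀ c d → s P c ≡ ((I₁ , I₂) , q) → s P d ≡ ((I₁ , I₂) , q) →
                proj₂ (proj₁ c) ≡ proj₂ (proj₁ d) → c ≡ d
    injective ((e₁ , e₂) , r) ((e₁′ , e₂′) , r′) sc sd refl = fibProd-edge-≡ (cong (_, e₂)
      (proj₁ (Ψ₁-lb I₁) e₁ e₁′ (cong (proj₁ ∘ proj₁) sc) (cong (proj₁ ∘ proj₁) sd)
        (trans r (sym r′))))
    surjective : ∀ f₂ → s H₂ f₂ ≡ I₂ →
                 ∃ λ c → s P c ≡ ((I₁ , I₂) , q) × proj₂ (proj₁ c) ≡ f₂
    surjective f₂ sf₂
      with e₁ , se₁ , Ψ₁e₁≡Ψ₂f₂ ← proj₂ (Ψ₁-lb I₁) (edge Ψ₂ f₂)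
                                   (trans (s-comm Ψ₂ f₂) (trans (cong (state Ψ₂) sf₂) (sym q))) =
      ((e₁ , f₂) , Ψ₁e₁≡Ψ₂f₂) , fibProd-state-≡ (cong₂ _,_ se₁ sf₂) , refl

incl-locallyBijective : ∀ {P} (C : SubGraph P) → Principal C → LocallyBijective (incl C)
incl-locallyBijective {P} C principal (I , I∈C) = injective , surjective
  where
  injective : ∀ c d → s (asGraph C) c ≡ (I , I∈C) → s (asGraph C) d ≡ (I , I∈C) →
              proj₁ c ≡ proj₁ d → c ≡ d
  injective _ _ _ _ = subtype-≡ T-irrelevant
  surjective : ∀ e → s P e ≡ I → ∃ λ c → s (asGraph C) c ≡ (I , I∈C) × proj₁ c ≡ e
  surjective e se = (e , principal I I∈C e se) , subtype-≡ T-irrelevant se , refl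

-- F(Φ (s e)) is mapped injectively by Ψ, so the target of e′ is pinned down by its image
bunchy-target : ∀ {G H M} {Φ : Hom G H} {Ψ : Hom H M} {γ : Hom G M} →
                (∀ I → state Ψ (state Φ I) ≡ state γ I) →
                ∀ e → BunchyAt Ψ (state Φ (s G e)) →
                ∀ e′ → s H e′ ≡ state Φ (s G e) → edge Ψ e′ ≡ edge γ e → t H e′ ≡ state Φ (t G e)
bunchy-target {G} {H} {M} {Φ} {Ψ} {γ} ΨΦ≡γ e bunchy e′ se′ Ψe′≡γe =
  proj₁ bunchy (t H e′) (state Φ (t G e)) (e′ , se′ , refl) (edge Φ e , s-comm Φ e , t-comm Φ e) (begin
    state Ψ (t H e′)          ≡⟨ sym (t-comm Ψ e′) ⟩
    t M (edge Ψ e′)           ≡⟨ cong (t M) Ψe′≡γe ⟩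
    t M (edge γ e)            ≡⟨ t-comm γ e ⟩
    state γ (t G e)           ≡⟨ sym (ΨΦ≡γ (t G e)) ⟩
    state Ψ (state Φ (t G e)) ∎)
  where open ≡-Reasoning

module FibreProductConstruction
    {H₁ H₂ M G : Graph} (finG : Finite (V G)) (finH₁ : Finite (V H₁)) (finH₂ : Finite (V H₂))
    (Ψ₁ : Hom H₁ M) (Ψ₁-lb : LocallyBijective Ψ₁) (bunchy₁ : ∀ J → BunchyAt Ψ₁ J)
    (Ψ₂ : Hom H₂ M) (Ψ₂-lb : LocallyBijective Ψ₂) (bunchy₂ : ∀ J → BunchyAt Ψ₂ J)
    (Φ₁ : Hom G H₁) (Φ₁-rr : RightResolver Φ₁) (Φ₂ : Hom G H₂) (Φ₂-rr : RightResolver Φ₂)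
    (sameState : ∀ I → state Ψ₁ (state Φ₁ I) ≡ state Ψ₂ (state Φ₂ I)) where

  P : Graph
  P = FibProd Ψ₁ Ψ₂

  Image : V P → Set
  Image ((I₁ , I₂) , _) = ∃ λ I → state Φ₁ I ≡ I₁ × state Φ₂ I ≡ I₂

  image? : ∀ J → Dec (Image J)
  image? ((I₁ , I₂) , _) =
    finite-any? finG λ I → finite-≟ finH₁ (state Φ₁ I) I₁ ×-dec finite-≟ finH₂ (state Φ₂ I) I₂

  target-image : ∀ c → Image (s P c) → Image (t P c)
  target-image ((e₁ , e₂) , r) (I , Φ₁I≡ , Φ₂I≡)
    with e , refl , refl ← proj₂ (proj₂ Φ₁-rr I) e₁ (sym Φ₁I≡) =
    t G e , sym (t-comm Φ₁ e) ,
    sym (bunchy-target {Φ = Φ₂} {Ψ₂} {Ψ₁ ∘ₕ Φ₁} (sym ∘ sameState) e (bunchy₂ _) e₂ (sym Φ₂I≡) (sym r))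

  C : SubGraph P
  C = record
    { inV  = λ J → ⌊ image? J ⌋
    ; inE  = λ c → ⌊ image? (s P c) ⌋
    ; s-in = λ _ in-image → in-image
    ; t-in = λ c in-image → fromWitness (target-image c (toWitness in-image))
    }

  C-principal : Principal C
  C-principal J J∈C c sc = subst (λ J′ → T ⌊ image? J′ ⌋) (sym sc) J∈C

  private
    CG : Graph
    CG = asGraph C

    C-state-≡ : {u v : V CG} → proj₁ (proj₁ u) ≡ proj₁ (proj₁ v) → u ≡ v
    C-state-≡ = subtype-≡ T-irrelevant ∘ fibProd-state-≡ Ψ₁ Ψ₂

    partner₂ : ∀ e → ∃ λ e₂ → s H₂ e₂ ≡ state Φ₂ (s G e) × edge Ψ₂ e₂ ≡ edge Ψ₁ (edge Φ₁ e)
    partner₂ e = proj₂ (Ψ₂-lb (state Φ₂ (s G e))) (edge Ψ₁ (edge Φ₁ e))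
      (trans (s-comm Ψ₁ (edge Φ₁ e)) (trans (cong (state Ψ₁) (s-comm Φ₁ e)) (sameState (s G e))))

    partner₁ : ∀ e → ∃ λ e₁ → s H₁ e₁ ≡ state Φ₁ (s G e) × edge Ψ₁ e₁ ≡ edge Ψ₂ (edge Φ₂ e)
    partner₁ e = proj₂ (Ψ₁-lb (state Φ₁ (s G e))) (edge Ψ₂ (edge Φ₂ e))
      (trans (s-comm Ψ₂ (edge Φ₂ e)) (trans (cong (state Ψ₂) (s-comm Φ₂ e)) (sym (sameState (s G e)))))

  Δ-state : V G → V CG
  Δ-state I = ((state Φ₁ I , state Φ₂ I) , sameState I) , fromWitness (I , refl , refl)

  Δ₁ : Hom G CG
  Δ₁ = record
    { edge   = λ e → ((edge Φ₁ e , proj₁ (partner₂ e)) , sym (proj₂ (proj₂ (partner₂ e)))) ,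
                     fromWitness (s G e , sym (s-comm Φ₁ e) , sym (proj₁ (proj₂ (partner₂ e))))
    ; state  = Δ-state
    ; s-comm = λ e → C-state-≡ (cong₂ _,_ (s-comm Φ₁ e) (proj₁ (proj₂ (partner₂ e))))
    ; t-comm = λ e → C-state-≡ (cong₂ _,_ (t-comm Φ₁ e)
        (bunchy-target {Φ = Φ₂} {Ψ₂} {Ψ₁ ∘ₕ Φ₁} (sym ∘ sameState) e (bunchy₂ _) _
          (proj₁ (proj₂ (partner₂ e))) (proj₂ (proj₂ (partner₂ e)))))
    }

  Δ₂ : Hom G CG
  Δ₂ = record
    { edge   = λ e → ((proj₁ (partner₁ e) , edge Φ₂ e) , proj₂ (proj₂ (partner₁ e))) ,
                     fromWitness (s G e , sym (proj₁ (proj₂ (partner₁ e))) , sym (s-comm Φ₂ e))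
    ; state  = Δ-state
    ; s-comm = λ e → C-state-≡ (cong₂ _,_ (proj₁ (proj₂ (partner₁ e))) (s-comm Φ₂ e))
    ; t-comm = λ e → C-state-≡ (cong₂ _,_
        (bunchy-target {Φ = Φ₁} {Ψ₁} {Ψ₂ ∘ₕ Φ₂} sameState e (bunchy₁ _) _
          (proj₁ (proj₂ (partner₁ e))) (proj₂ (proj₂ (partner₁ e))))
        (t-comm Φ₂ e))
    }

  π₁ : Hom CG H₁
  π₁ = proj₁ₕ Ψ₁ Ψ₂ ∘ₕ incl C

  π₂ : Hom CG H₂
  π₂ = proj₂ₕ Ψ₁ Ψ₂ ∘ₕ incl C

  private
    Δ-state-surjective : StrictlySurjective _≡_ Δ-state
    Δ-state-surjective (_ , J∈C) with I , refl , refl ← toWitness J∈C = I , C-state-≡ refl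

    π₁-lb : LocallyBijective π₁
    π₁-lb = ∘-locallyBijective {Φ = incl C} {proj₁ₕ Ψ₁ Ψ₂}
      (incl-locallyBijective C C-principal) (proj₁ₕ-locallyBijective Ψ₁ Ψ₂ Ψ₂-lb)

    π₂-lb : LocallyBijective π₂
    π₂-lb = ∘-locallyBijective {Φ = incl C} {proj₂ₕ Ψ₁ Ψ₂}
      (incl-locallyBijective C C-principal) (proj₂ₕ-locallyBijective Ψ₁ Ψ₂ Ψ₁-lb)

  Δ₁-rightResolver : RightResolver Δ₁
  Δ₁-rightResolver = locallyBijective⇒rightResolver Δ₁ Δ-state-surjective
    (locallyBijective-factor {Δ = Δ₁} {π₁} (proj₂ Φ₁-rr) π₁-lb)

  Δ₂-rightResolver : RightResolver Δ₂
  Δ₂-rightResolver = locallyBijective⇒rightResolver Δ₂ Δ-state-surjective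
    (locallyBijective-factor {Δ = Δ₂} {π₂} (proj₂ Φ₂-rr) π₂-lb)

  π₁-rightResolver : RightResolver π₁
  π₁-rightResolver = locallyBijective⇒rightResolver π₁
    (λ J → Product.map Δ-state id (proj₂ (proj₁ Φ₁-rr) J)) π₁-lb

  π₂-rightResolver : RightResolver π₂
  π₂-rightResolver = locallyBijective⇒rightResolver π₂
    (λ J → Product.map Δ-state id (proj₂ (proj₁ Φ₂-rr) J)) π₂-lb

theorem5p15 :
    (H₁ H₂ M G : Graph) →
    IsGraph H₁ → IsGraph H₂ → IsGraph M → IsGraph G →
    Bunchy H₁ → Bunchy H₂ →
    IsMinimalOf M H₁ → IsMinimalOf M H₂ →
    (Ψ₁ : Hom H₁ M) → RightResolver Ψ₁ →
    (Ψ₂ : Hom H₂ M) → RightResolver Ψ₂ →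
    (Φ₁ : Hom G H₁) → RightResolver Φ₁ →
    (Φ₂ : Hom G H₂) → RightResolver Φ₂ →
    Σ (SubGraph (FibProd Ψ₁ Ψ₂)) λ C →
      Principal C ×
      (Σ (Hom G (asGraph C)) λ Δ₁ → Σ (Hom G (asGraph C)) λ Δ₂ →
        RightResolver Δ₁ × RightResolver Δ₂ ×
        Φ₁ ≈ₕ ((proj₁ₕ Ψ₁ Ψ₂ ∘ₕ incl C) ∘ₕ Δ₁) ×
        Φ₂ ≈ₕ ((proj₂ₕ Ψ₁ Ψ₂ ∘ₕ incl C) ∘ₕ Δ₂) ×
        (∀ I → state Δ₁ I ≡ state Δ₂ I))
      × RightResolver (proj₁ₕ Ψ₁ Ψ₂ ∘ₕ incl C)
      × RightResolver (proj₂ₕ Ψ₁ Ψ₂ ∘ₕ incl C)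
theorem5p15 H₁ H₂ M G H₁-graph H₂-graph M-graph G-graph H₁-bunchy H₂-bunchy M-min₁ M-min₂
            Ψ₁ Ψ₁-rr Ψ₂ Ψ₂-rr Φ₁ Φ₁-rr Φ₂ Φ₂-rr =
  C , C-principal ,
  (Δ₁ , Δ₂ , Δ₁-rightResolver , Δ₂-rightResolver ,
   ((λ _ → refl) , (λ _ → refl)) , ((λ _ → refl) , (λ _ → refl)) , (λ _ → refl)) ,
  π₁-rightResolver , π₂-rightResolver
  where
  sameState : ∀ I → state Ψ₁ (state Φ₁ I) ≡ state Ψ₂ (state Φ₂ I)
  sameState = minimal⇒uniqueStateMap (proj₁ G-graph) M-graph (proj₂ (proj₂ M-min₁))
    (Ψ₁ ∘ₕ Φ₁) (Ψ₂ ∘ₕ Φ₂)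
    (∘-locallyBijective {Φ = Φ₁} {Ψ₁} (proj₂ Φ₁-rr) (proj₂ Ψ₁-rr))
    (∘-locallyBijective {Φ = Φ₂} {Ψ₂} (proj₂ Φ₂-rr) (proj₂ Ψ₂-rr))

  open FibreProductConstruction (proj₁ G-graph) (proj₁ H₁-graph) (proj₁ H₂-graph)
    Ψ₁ (proj₂ Ψ₁-rr) (H₁-bunchy M M-min₁ Ψ₁ Ψ₁-rr)
    Ψ₂ (proj₂ Ψ₂-rr) (H₂-bunchy M M-min₂ Ψ₂ Ψ₂-rr)
    Φ₁ Φ₁-rr Φ₂ Φ₂-rr sameState
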